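{- Let $\Gamma$ and $\Sigma$ be regular graphs with coprime valencies, and suppose that $\Sigma$ is $R$-thin. Then for any $u\in V(\Gamma)$, any $\sigma\in\mathrm{Aut}(\Gamma\times\Sigma)$ and any edge $\{i,j\}$ of $B(\Sigma)$, we have $(u,i)^{\sigma\pi_\Sigma}\neq(u,j)^{\sigma\pi_\Sigma}$.
   Context: Graphs are finite and simple. The direct product $\Gamma\times\Sigma$ has vertex set $V(\Gamma)\times V(\Sigma)$, with $(u,x)\sim(v,y)$ iff $u\sim v$ in $\Gamma$ and $x\sim y$ in $\Sigma$. A graph is $R$-thin if distinct vertices have distinct neighbourhoods. The Boolean square $B(\Delta)$ of a graph $\Delta$ has vertex set $V(\Delta)$ and edges $\{x,y\}$ for distinct $x,y$ with $N_\Delta(x)\cap N_\Delta(y)\neq\emptyset$. $\pi_\Sigma:V(\Gamma\times\Sigma)\to V(\Sigma)$ is the projection $(u,i)\mapsto i$ (and $\pi_\Gamma$ the projection to $V(\Gamma)$). Maps act on the right: $x^{\sigma\pi_\Sigma}$ means apply $\sigma$ then $\pi_\Sigma$. -}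

module Defs where

open import Data.Nat using (ℕ)
open import Data.Fin using (Fin)
open import Data.Fin.Properties using (all?)
open import Data.Bool using (Bool; true; false; T)
open import Data.Product using (_×_; _,_; proj₁; proj₂; ∃)
open import Data.List using (List; filter; length)
open import Data.List using () renaming (map to lmap)
open import Data.Vec.Functional using ()
open import Data.Fin.Base using ()
open import Data.List.Base using (allFin)
open import Relation.Binary.PropositionalEquality using (_≡_; _≢_)
open import Relation.Nullary using (¬_)
open import Relation.Nullary.Decidable using (does)
open import Data.Bool.Properties using (T?)
open import Function.Bundles using (_↔_; Inverse)

record Graph (n : ℕ) : Set where
  field
    adj       : Fin n → Fin n → Bool
    symmetric : ∀ x y → adj x y ≡ adj y x
    irrefl    : ∀ x → adj x x ≡ false
open Graph public

_∼⟨_⟩_ : ∀ {n} → Fin n → Graph n → Fin n → Set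
x ∼⟨ G ⟩ y = T (adj G x y)

degree : ∀ {n} → Graph n → Fin n → ℕ
degree {n} G x = length (filter (λ y → T? (adj G x y)) (allFin n))

IsRegular : ∀ {n} → Graph n → ℕ → Set
IsRegular G k = ∀ x → degree G x ≡ k

RThin : ∀ {n} → Graph n → Set
RThin G = ∀ x y → (∀ z → adj G x z ≡ adj G y z) → x ≡ y

_⊗_ : ∀ {n m} → Graph n → Graph m → (Fin n × Fin m) → (Fin n × Fin m) → Set
(Γ ⊗ Σ) (u , x) (v , y) = (u ∼⟨ Γ ⟩ v) × (x ∼⟨ Σ ⟩ y)

record Aut× {n m} (Γ : Graph n) (Σ : Graph m) : Set where
  field
    perm : (Fin n × Fin m) ↔ (Fin n × Fin m)
  open Inverse perm public using (to)
  field
    preserves : ∀ p q → (Γ ⊗ Σ) p q → (Γ ⊗ Σ) (to p) (to q)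
    reflects  : ∀ p q → (Γ ⊗ Σ) (to p) (to q) → (Γ ⊗ Σ) p q

BEdge : ∀ {n} → Graph n → Fin n → Fin n → Set
BEdge Δ x y = x ≢ y × ∃ λ z → (x ∼⟨ Δ ⟩ z) × (y ∼⟨ Δ ⟩ z)

-- In Γ × Σ the number of common neighbours of
-- (a , x) and (b , y) is the product of the counts in Γ and in Σ, and an
-- automorphism preserves it. If (u , i) and (u , j) had images (a , x) and
-- (b , x) with the same Σ-coordinate, then k · c(i , j) = c(a , b) · l, so by
-- coprimality l divides c(i , j). As 0 < c(i , j) ≤ deg i = l, this forces
-- c(i , j) = l, i.e. i and j have the same neighbourhood, and R-thinness gives
-- i = j, contradicting that {i , j} is an edge of B(Σ).
module Submission where

open import Defs
open import Data.Nat using (ℕ)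
open import Data.Nat.Coprimality using (Coprime)
open import Data.Fin using (Fin)
open import Data.Product using (_,_; proj₂)
open import Relation.Binary.PropositionalEquality using (_≢_)

open import Algebra.Bundles using (CommutativeMonoid)
open import Data.Bool using (Bool; true; false; T; _∧_; not)
open import Data.Bool.Properties using (T?; T-∧; ∧-comm; ∧-idem; ∧-commutativeMonoid)
open import Data.Empty using (⊥-elim)
open import Data.Fin using (zero; suc; _↑ˡ_; _↑ʳ_; combine; remQuot)
open import Data.Fin.Permutation using (Permutation)
open import Data.Fin.Properties using (remQuot-combine; *↔×)
open import Data.List using (filter; length; tabulate)
open import Data.Nat using (zero; suc; _+_; _*_; _≤_; ≢-nonZero)
import Data.Nat.Coprimality as Coprimality
open import Data.Nat.Coprimality using (coprime-divisor)
open import Data.Nat.Divisibility using (_∣_; divides; ∣⇒≤)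
open import Data.Nat.Properties
  using (+-*-semiring; +-assoc; +-cancelˡ-≡; +-identityʳ; m+n≡0⇒m≡0; m+n≡0⇒n≡0; m≤m+n; ≤-antisym)
open import Data.Product using (_×_; proj₁; uncurry)
open import Function using (_∘_; _↔_; Inverse; Equivalence)
open import Function.Construct.Composition using (_↔-∘_)
open import Function.Construct.Symmetry using (↔-sym)
open import Relation.Binary.PropositionalEquality
  using (_≡_; refl; sym; trans; cong; cong₂; subst; module ≡-Reasoning)

open import Algebra.Properties.Semiring.Sum +-*-semiring
  using (sum; sum-syntax; sum-cong-≗; sum-permute; ∑-distrib-+; *-distribˡ-sum; *-distribʳ-sum)
open import Algebra.Properties.CommutativeSemigroup
  (CommutativeMonoid.commutativeSemigroup ∧-commutativeMonoid)
  using (interchange)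

open ≡-Reasoning

private
  variable
    n m : ℕ

indicator : Bool → ℕ
indicator true  = 1
indicator false = 0

indicator-∧ : ∀ x y → indicator (x ∧ y) ≡ indicator x * indicator y
indicator-∧ true  true  = refl
indicator-∧ true  false = refl
indicator-∧ false y     = refl

T-injective : ∀ {x y} → (T x → T y) → (T y → T x) → x ≡ y
T-injective {true}  {true}  _   _   = refl
T-injective {true}  {false} x⇒y _   = ⊥-elim (x⇒y _)
T-injective {false} {true}  _   y⇒x = ⊥-elim (y⇒x _)
T-injective {false} {false} _   _   = refl

count : (Fin n → Bool) → ℕ
count {n} p = ∑[ a < n ] indicator (p a)

length-filter-tabulate : ∀ {A : Set} (p : A → Bool) (f : Fin n → A) →
                         length (filter (T? ∘ p) (tabulate f)) ≡ count (p ∘ f)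
length-filter-tabulate {zero}  p f = refl
length-filter-tabulate {suc n} p f with p (f zero)
... | true  = cong suc (length-filter-tabulate p (f ∘ suc))
... | false = length-filter-tabulate p (f ∘ suc)

count-split : (p q : Fin n → Bool) →
              count p ≡ count (λ a → p a ∧ q a) + count (λ a → p a ∧ not (q a))
count-split p q = trans (sum-cong-≗ (λ a → split (p a) (q a)))
  (∑-distrib-+ (λ a → indicator (p a ∧ q a)) (λ a → indicator (p a ∧ not (q a))))
  where
  split : ∀ x y → indicator x ≡ indicator (x ∧ y) + indicator (x ∧ not y)
  split true  true  = refl
  split true  false = refl
  split false y     = refl

count≡0⇒false : (p : Fin n → Bool) → count p ≡ 0 → ∀ a → p a ≡ false
count≡0⇒false p eq zero    = indicator≡0⇒false (m+n≡0⇒m≡0 (indicator (p zero)) eq)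
  where
  indicator≡0⇒false : ∀ {x} → indicator x ≡ 0 → x ≡ false
  indicator≡0⇒false {false} _ = refl
count≡0⇒false p eq (suc a) = count≡0⇒false (p ∘ suc) (m+n≡0⇒n≡0 (indicator (p zero)) eq) a

count-∧≤count : (p q : Fin n → Bool) → count (λ a → p a ∧ q a) ≤ count p
count-∧≤count p q = subst (count (λ a → p a ∧ q a) ≤_) (sym (count-split p q)) (m≤m+n _ _)

count-∧≡count⇒∧not≡0 : (p q : Fin n → Bool) → count (λ a → p a ∧ q a) ≡ count p →
                       count (λ a → p a ∧ not (q a)) ≡ 0
count-∧≡count⇒∧not≡0 p q eq = +-cancelˡ-≡ (count (λ a → p a ∧ q a)) _ 0 (begin
  count (λ a → p a ∧ q a) + count (λ a → p a ∧ not (q a)) ≡⟨ count-split p q ⟨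
  count p                                                  ≡⟨ eq ⟨
  count (λ a → p a ∧ q a)                                  ≡⟨ +-identityʳ _ ⟨
  count (λ a → p a ∧ q a) + 0                              ∎)

count-∧≡count⇒≗ : (p q : Fin n → Bool) →
                  count (λ a → p a ∧ q a) ≡ count p → count (λ a → p a ∧ q a) ≡ count q →
                  ∀ a → p a ≡ q a
count-∧≡count⇒≗ p q eqp eqq a =
  both-differences-false (p a) (q a)
    (count≡0⇒false _ (count-∧≡count⇒∧not≡0 p q eqp) a)
    (count≡0⇒false _ (count-∧≡count⇒∧not≡0 q p (trans count-∧-comm eqq)) a)
  where
  both-differences-false : ∀ x y → x ∧ not y ≡ false → y ∧ not x ≡ false → x ≡ y
  both-differences-false true  true  _ _ = refl
  both-differences-false false false _ _ = refl
  count-∧-comm : count (λ b → q b ∧ p b) ≡ count (λ b → p b ∧ q b)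
  count-∧-comm = sum-cong-≗ (λ b → cong indicator (∧-comm (q b) (p b)))

sum-↑ : ∀ a {b} (f : Fin (a + b) → ℕ) → sum f ≡ sum (f ∘ (_↑ˡ b)) + sum (f ∘ (a ↑ʳ_))
sum-↑ zero    f = refl
sum-↑ (suc a) f = trans (cong (f zero +_) (sum-↑ a (f ∘ suc))) (sym (+-assoc (f zero) _ _))

sum-combine : ∀ n m (f : Fin (n * m) → ℕ) → sum f ≡ ∑[ i < n ] ∑[ j < m ] f (combine i j)
sum-combine zero    m f = refl
sum-combine (suc n) m f =
  trans (sum-↑ m f) (cong (sum (f ∘ (_↑ˡ n * m)) +_) (sum-combine n m (f ∘ (m ↑ʳ_))))

∑× : (Fin n × Fin m → ℕ) → ℕ
∑× {n} {m} f = ∑[ i < n ] ∑[ j < m ] f (i , j)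

∑×-cong : {f g : Fin n × Fin m → ℕ} → (∀ r → f r ≡ g r) → ∑× f ≡ ∑× g
∑×-cong f≗g = sum-cong-≗ λ i → sum-cong-≗ λ j → f≗g (i , j)

sum∘remQuot : (f : Fin n × Fin m → ℕ) → sum (f ∘ remQuot m) ≡ ∑× f
sum∘remQuot {n} {m} f = trans (sum-combine n m (f ∘ remQuot m))
  (∑×-cong λ (i , j) → cong f (remQuot-combine i j))

-- The library's permutation invariance is for sums over Fin k, so π is
-- transported to Fin (n * m) along combine/remQuot.
∑×-permute : (f : Fin n × Fin m → ℕ) (π : (Fin n × Fin m) ↔ (Fin n × Fin m)) →
             ∑× f ≡ ∑× (f ∘ Inverse.to π)
∑×-permute {n} {m} f π = begin
  ∑× f                               ≡⟨ sum∘remQuot f ⟨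
  sum (f ∘ remQuot m)                ≡⟨ sum-permute (f ∘ remQuot m) ρ ⟩
  sum (f ∘ remQuot m ∘ Inverse.to ρ) ≡⟨ sum-cong-≗ (λ w → cong f (uncurry remQuot-combine (Inverse.to π (remQuot m w)))) ⟩
  sum (f ∘ Inverse.to π ∘ remQuot m) ≡⟨ sum∘remQuot (f ∘ Inverse.to π) ⟩
  ∑× (f ∘ Inverse.to π)              ∎
  where
  ρ : Permutation (n * m) (n * m)
  ρ = ↔-sym *↔× ↔-∘ (π ↔-∘ *↔×)

∑×-product : (f : Fin n → ℕ) (g : Fin m → ℕ) → ∑× (λ (v , z) → f v * g z) ≡ sum f * sum g
∑×-product f g = begin
  ∑× (λ (v , z) → f v * g z) ≡⟨ sum-cong-≗ (λ v → *-distribˡ-sum (f v) g) ⟨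
  sum (λ v → f v * sum g)    ≡⟨ *-distribʳ-sum (sum g) f ⟨
  sum f * sum g              ∎

commonNeighbours : Graph n → Fin n → Fin n → ℕ
commonNeighbours G x y = count (λ z → adj G x z ∧ adj G y z)

degree≡count : (G : Graph n) (x : Fin n) → degree G x ≡ count (adj G x)
degree≡count G x = length-filter-tabulate (adj G x) (λ z → z)

commonNeighbours-diag : (G : Graph n) (x : Fin n) → commonNeighbours G x x ≡ degree G x
commonNeighbours-diag G x =
  trans (sum-cong-≗ (λ z → cong indicator (∧-idem (adj G x z)))) (sym (degree≡count G x))

commonNeighbours≢0 : (G : Graph n) {x y z : Fin n} → x ∼⟨ G ⟩ z → y ∼⟨ G ⟩ z →
                     commonNeighbours G x y ≢ 0
commonNeighbours≢0 G {x} {y} {z} x∼z y∼z c≡0 =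
  subst T (count≡0⇒false _ c≡0 z) (Equivalence.from T-∧ (x∼z , y∼z))

regular-∣commonNeighbours⇒sameNeighbours :
  ∀ {l} (G : Graph n) → IsRegular G l → {x y z : Fin n} → x ∼⟨ G ⟩ z → y ∼⟨ G ⟩ z →
  l ∣ commonNeighbours G x y → ∀ w → adj G x w ≡ adj G y w
regular-∣commonNeighbours⇒sameNeighbours {l = l} G regular {x} {y} x∼z y∼z l∣c =
  count-∧≡count⇒≗ (adj G x) (adj G y) (trans c≡l (l≡count x)) (trans c≡l (l≡count y))
  where
  c = commonNeighbours G x y
  l≡count : ∀ v → l ≡ count (adj G v)
  l≡count v = trans (sym (regular v)) (degree≡count G v)
  c≡l : c ≡ l
  c≡l = ≤-antisym (subst (c ≤_) (sym (l≡count x)) (count-∧≤count (adj G x) (adj G y)))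
                  (∣⇒≤ {{≢-nonZero (commonNeighbours≢0 G x∼z y∼z)}} l∣c)

module _ (Γ : Graph n) (Δ : Graph m) where

  ×adj : Fin n × Fin m → Fin n × Fin m → Bool
  ×adj (u , x) (v , y) = adj Γ u v ∧ adj Δ x y

  commonNeighbours× : Fin n × Fin m → Fin n × Fin m → ℕ
  commonNeighbours× p q = ∑× (λ r → indicator (×adj p r ∧ ×adj q r))

  commonNeighbours×-factor : ∀ a x b y →
    commonNeighbours× (a , x) (b , y) ≡ commonNeighbours Γ a b * commonNeighbours Δ x y
  commonNeighbours×-factor a x b y = trans
    (∑×-cong λ (v , z) → trans (cong indicator (interchange (adj Γ a v) (adj Δ x z) (adj Γ b v) (adj Δ y z)))
                               (indicator-∧ (adj Γ a v ∧ adj Γ b v) (adj Δ x z ∧ adj Δ y z)))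
    (∑×-product (λ v → indicator (adj Γ a v ∧ adj Γ b v)) (λ z → indicator (adj Δ x z ∧ adj Δ y z)))

  ×adj-automorphism : (σ : Aut× Γ Δ) → ∀ p r → ×adj (Aut×.to σ p) (Aut×.to σ r) ≡ ×adj p r
  ×adj-automorphism σ p r = T-injective
    (Equivalence.from T-∧ ∘ Aut×.reflects σ p r ∘ Equivalence.to T-∧)
    (Equivalence.from T-∧ ∘ Aut×.preserves σ p r ∘ Equivalence.to T-∧)

  commonNeighbours×-automorphism : (σ : Aut× Γ Δ) → ∀ p q →
    commonNeighbours× (Aut×.to σ p) (Aut×.to σ q) ≡ commonNeighbours× p q
  commonNeighbours×-automorphism σ p q = begin
    commonNeighbours× (to p) (to q)
      ≡⟨ ∑×-permute _ (Aut×.perm σ) ⟩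
    ∑× (λ r → indicator (×adj (to p) (to r) ∧ ×adj (to q) (to r)))
      ≡⟨ ∑×-cong (λ r → cong indicator (cong₂ _∧_ (×adj-automorphism σ p r) (×adj-automorphism σ q r))) ⟩
    commonNeighbours× p q
      ∎
    where open Aut× σ using (to)

lemma4p4 : ∀ {n m} (Γ : Graph n) (Σ : Graph m) (k l : ℕ) →
           IsRegular Γ k → IsRegular Σ l → Coprime k l → RThin Σ →
           ∀ (u : Fin n) (σ : Aut× Γ Σ) (i j : Fin m) → BEdge Σ i j →
           proj₂ (Aut×.to σ (u , i)) ≢ proj₂ (Aut×.to σ (u , j))
lemma4p4 Γ Σ k l regularΓ regularΣ k⊥l thin u σ i j (i≢j , z , i∼z , j∼z) σi≡σj =
  i≢j (thin i j (regular-∣commonNeighbours⇒sameNeighbours Σ regularΣ i∼z j∼z l∣c))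
  where
  open Aut× σ using (to)
  a = proj₁ (to (u , i))
  b = proj₁ (to (u , j))
  x = proj₂ (to (u , i))
  y = proj₂ (to (u , j))
  c = commonNeighbours Σ i j
  d = commonNeighbours Γ a b
  k*c≡d*l : k * c ≡ d * l
  k*c≡d*l = begin
    k * c                                 ≡⟨ cong (_* c) (trans (sym (regularΓ u)) (sym (commonNeighbours-diag Γ u))) ⟩
    commonNeighbours Γ u u * c            ≡⟨ commonNeighbours×-factor Γ Σ u i u j ⟨
    commonNeighbours× Γ Σ (u , i) (u , j) ≡⟨ commonNeighbours×-automorphism Γ Σ σ (u , i) (u , j) ⟨
    commonNeighbours× Γ Σ (a , x) (b , y) ≡⟨ commonNeighbours×-factor Γ Σ a x b y ⟩
    d * commonNeighbours Σ x y            ≡⟨ cong (λ y′ → d * commonNeighbours Σ x y′) σi≡σj ⟨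
    d * commonNeighbours Σ x x            ≡⟨ cong (d *_) (trans (commonNeighbours-diag Σ x) (regularΣ x)) ⟩
    d * l                                 ∎
  l∣c : l ∣ c
  l∣c = coprime-divisor (Coprimality.sym k⊥l) (divides d k*c≡d*l)
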